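{- If $G$ is a graph such that $\mathcal{G}=\{L\}$, then $\mathrm{nim}(\mathrm{GEN}(G))=\mathrm{pty}(V)$.
   Context: Let $G=(V,E)$ be a finite graph. A set of vertices is geodetically convex if it contains every vertex on every shortest path (geodesic) between two of its vertices; the convex hull $[P]$ of $P\subseteq V$ is the smallest convex set containing $P$, and $P$ is generating if $[P]=V$. $\mathcal{G}$ denotes the family of minimal generating sets of $G$; the hypothesis $\mathcal{G}=\{L\}$ means $G$ has a unique minimal generating set $L$. In the achievement game $\mathrm{GEN}(G)$, two players alternately select previously-unselected vertices; the game ends as soon as the convex hull of the jointly-selected vertices equals $V$, and the last player to move wins. $\mathrm{nim}$ denotes the nim-number (Sprague–Grundy value) of an impartial game, and $\mathrm{pty}(A):=|A| \bmod 2$ is the parity of a set. -}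

module Defs where

open import Data.Nat using (ℕ; zero; suc; _≤_; _<_)
open import Data.Bool using (Bool; true; false)
open import Data.Fin using (Fin)
open import Data.Fin.Subset using (Subset; _∈_; _∉_; _⊆_; _⊂_; _∪_; ⁅_⁆; ⊥)
open import Data.Product using (Σ; ∃; ∃-syntax; _×_; _,_)
open import Data.Sum using (_⊎_)
open import Relation.Nullary using (¬_)
open import Relation.Binary.PropositionalEquality using (_≡_; _≢_)

record Graph (n : ℕ) : Set where
  field
    edge     : Fin n → Fin n → Bool
    symmetric : ∀ u v → edge u v ≡ edge v u
    loopless  : ∀ v → edge v v ≡ false

module _ {n : ℕ} (G : Graph n) where
  open Graph G

  Adj : Fin n → Fin n → Set
  Adj u v = edge u v ≡ true

  data Walk : Fin n → Fin n → ℕ → Set where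
    here : ∀ a → Walk a a 0
    step : ∀ {a b c k} → Adj a b → Walk b c k → Walk a c (suc k)

  visits : ∀ {a b k} → Walk a b k → Fin n → Set
  visits (here a) v = v ≡ a
  visits (step {a = a} _ w) v = v ≡ a ⊎ visits w v

  IsGeodesic : ∀ {a b k} → Walk a b k → Set
  IsGeodesic {a} {b} {k} _ = ∀ k' → Walk a b k' → k ≤ k'

  OnGeodesic : Fin n → Fin n → Fin n → Set
  OnGeodesic a b v = ∃[ k ] Σ (Walk a b k) λ w → IsGeodesic w × visits w v

  Convex : Subset n → Set
  Convex C = ∀ a b v → a ∈ C → b ∈ C → OnGeodesic a b v → v ∈ C

  InHull : Subset n → Fin n → Set
  InHull P v = ∀ C → Convex C → P ⊆ C → v ∈ C

  Generating : Subset n → Set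
  Generating P = ∀ v → InHull P v

  MinimalGenerating : Subset n → Set
  MinimalGenerating P = Generating P × (∀ R → R ⊂ P → ¬ Generating R)

  -- A position is the set P of
  -- already selected vertices; it is terminal iff P is generating;
  -- otherwise its options are P ∪ {v} for unselected v.
  -- NimIs f P k : "the nim-number of position P is k", defined by
  -- recursion on a fuel f (f = n suffices from the empty position,
  -- since each move selects a new vertex): k = 0 at terminal positions,
  -- and otherwise k = mex of the nim-numbers of the options.
  NimIs : ℕ → Subset n → ℕ → Set
  NimIs zero P k = Generating P × k ≡ 0
  NimIs (suc f) P k =
      (Generating P × k ≡ 0)
    ⊎ (¬ Generating P
       × (∀ v → v ∉ P → ∀ m → NimIs f (P ∪ ⁅ v ⁆) m → m ≢ k)
       × (∀ j → j < k → ∃[ v ] (v ∉ P × NimIs f (P ∪ ⁅ v ⁆) j)))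

  NimGEN : ℕ → Set
  NimGEN k = NimIs n ⊥ k

{-# OPTIONS --safe #-}
-- Every generating set contains a minimal one, so when L is the only minimal
-- generating set a position P of GEN(G) is terminal exactly when L ⊆ P.  The
-- game then depends only on the number a of unselected vertices of L and the
-- number u of all unselected vertices, and induction on u through the mex
-- recursion gives its nim-number: 0 if a = 0, 1 or 2 as u is odd or even if
-- a = 1, and the parity of u if a ≥ 2.  At the start u = |V|; moreover ∅ and
-- singletons are convex, so |L| = 0 forces |V| = 0 and |L| = 1 forces |V| = 1,
-- and in every case the value is pty(V).
module Submission where

open import Defs
open import Data.Nat using (ℕ; zero; suc; _%_; _≤_; _<_; z≤n; s≤s)
open import Data.Nat.Properties using (≤-trans; ≤-refl; <⇒≱; 1+n≢n; suc-injective; +-comm; <-cmp)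
open import Data.Nat.DivMod using ([m+n]%n≡m%n)
open import Data.Nat.Induction using (<-wellFounded)
open import Induction.WellFounded using (Acc; acc)
open import Data.Fin using (Fin; zero; suc)
open import Data.Fin.Properties using (any?)
open import Data.Fin.Subset
  using (Subset; Nonempty; inside; outside; _∈_; _∉_; _⊆_; _⊂_; _∪_; _─_; _-_; ∣_∣; ⁅_⁆; ⊥; ⊤)
open import Data.Fin.Subset.Properties
  using ( _∈?_; drop-there; ∉⊥; ∈⊤; ∣⊥∣≡0; ∣⊤∣≡n; p⊆q⇒∣p∣≤∣q∣; p⊂q⇒∣p∣<∣q∣; p⊂q⇒p⊆q; ⊆-refl; ⊆-trans
        ; p─⊥≡p; p─q─r≡p─q∪r; p─q⊆p; x∈p∧x∉q⇒x∈p─q; x∈p∧x≢y⇒x∈p-y; x∈⁅x⁆; x∈⁅y⁆⇒x≡y; x∉⁅y⁆⇒x≢y)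
open import Data.Vec using (_∷_; here; there)
open import Data.Product using (_×_; _,_; proj₁; proj₂; ∃-syntax)
open import Data.Empty using (⊥-elim)
open import Data.Sum using (_⊎_; inj₁; inj₂)
open import Function using (_∘_; _⇔_; mk⇔; Equivalence)
open import Relation.Nullary using (¬_; yes; no; ¬?; contradiction)
open import Relation.Nullary.Decidable using (_×-dec_; decidable-stable)
open import Relation.Binary.PropositionalEquality using (_≡_; _≢_; refl; sym; trans; cong; subst; subst₂)
open import Relation.Binary using (tri<; tri≈; tri>)

private
  variable
    n : ℕ
    x : Fin n
    p q : Subset n

x∈p─q⇒x∉q : ∀ (p q : Subset n) → x ∈ p ─ q → x ∉ q
x∈p─q⇒x∉q (_ ∷ p) (outside ∷ q) here = λ ()
x∈p─q⇒x∉q (_ ∷ p) (_ ∷ q) (there x∈p─q) = x∈p─q⇒x∉q p q x∈p─q ∘ drop-there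

x∈p⇒∣p∣≡1+∣p-x∣ : x ∈ p → ∣ p ∣ ≡ suc ∣ p - x ∣
x∈p⇒∣p∣≡1+∣p-x∣ {p = inside ∷ p} here = cong (suc ∘ ∣_∣) (sym (p─⊥≡p p))
x∈p⇒∣p∣≡1+∣p-x∣ {p = inside ∷ p} (there x∈p) = cong suc (x∈p⇒∣p∣≡1+∣p-x∣ x∈p)
x∈p⇒∣p∣≡1+∣p-x∣ {p = outside ∷ p} (there x∈p) = x∈p⇒∣p∣≡1+∣p-x∣ x∈p

x∉p⇒p-x≡p : x ∉ p → p - x ≡ p
x∉p⇒p-x≡p {x = zero} {outside ∷ p} _ = cong (outside ∷_) (p─⊥≡p p)
x∉p⇒p-x≡p {x = zero} {inside ∷ p} x∉p = contradiction here x∉p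
x∉p⇒p-x≡p {x = suc x} {s ∷ p} x∉p = cong (s ∷_) (x∉p⇒p-x≡p (x∉p ∘ there))

∣p∣≡0⇒x∉p : ∣ p ∣ ≡ 0 → x ∉ p
∣p∣≡0⇒x∉p ∣p∣≡0 x∈p with () ← trans (sym ∣p∣≡0) (x∈p⇒∣p∣≡1+∣p-x∣ x∈p)

∣p∣<∣q∣⇒∃x∈q∖p : ∣ p ∣ < ∣ q ∣ → ∃[ x ] (x ∈ q × x ∉ p)
∣p∣<∣q∣⇒∃x∈q∖p {p = p} {q} ∣p∣<∣q∣ with any? (λ x → x ∈? q ×-dec ¬? (x ∈? p))
... | yes found = found
... | no none = contradiction (p⊆q⇒∣p∣≤∣q∣ q⊆p) (<⇒≱ ∣p∣<∣q∣)
  where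
  q⊆p : q ⊆ p
  q⊆p {x} x∈q = decidable-stable (x ∈? p) (λ x∉p → none (x , x∈q , x∉p))

0<∣p∣⇒nonempty : 0 < ∣ p ∣ → Nonempty p
0<∣p∣⇒nonempty {n} {p} 0<∣p∣
  with x , x∈p , _ ← ∣p∣<∣q∣⇒∃x∈q∖p {p = ⊥} {q = p} (subst (_< ∣ p ∣) (sym (∣⊥∣≡0 n)) 0<∣p∣)
  = x , x∈p

0<∣q─p∣⇒∃x∈q∖p : ∀ (q p : Subset n) → 0 < ∣ q ─ p ∣ → ∃[ x ] (x ∈ q × x ∉ p)
0<∣q─p∣⇒∃x∈q∖p q p 0<∣q─p∣ with x , x∈q─p ← 0<∣p∣⇒nonempty {p = q ─ p} 0<∣q─p∣ =
  x , p─q⊆p q p x∈q─p , x∈p─q⇒x∉q q p x∈q─p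

∣p∣≡1⇒p⊆⁅x⁆ : ∣ p ∣ ≡ 1 → ∃[ x ] p ⊆ ⁅ x ⁆
∣p∣≡1⇒p⊆⁅x⁆ {p = p} ∣p∣≡1 with 0<∣p∣⇒nonempty {p = p} (subst (0 <_) (sym ∣p∣≡1) (s≤s z≤n))
... | x , x∈p = x , p⊆⁅x⁆
  where
  ∣p-x∣≡0 : ∣ p - x ∣ ≡ 0
  ∣p-x∣≡0 = suc-injective (trans (sym (x∈p⇒∣p∣≡1+∣p-x∣ x∈p)) ∣p∣≡1)

  p⊆⁅x⁆ : p ⊆ ⁅ x ⁆
  p⊆⁅x⁆ {y} y∈p = decidable-stable (y ∈? ⁅ x ⁆)
    (λ y∉⁅x⁆ → ∣p∣≡0⇒x∉p {p = p - x} ∣p-x∣≡0 (x∈p∧x≢y⇒x∈p-y y∈p (x∉⁅y⁆⇒x≢y y∉⁅x⁆)))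

∣q─p∣≡0⇒q⊆p : ∣ q ─ p ∣ ≡ 0 → q ⊆ p
∣q─p∣≡0⇒q⊆p {q = q} {p} ∣q─p∣≡0 {x} x∈q =
  decidable-stable (x ∈? p) (∣p∣≡0⇒x∉p {p = q ─ p} ∣q─p∣≡0 ∘ x∈p∧x∉q⇒x∈p─q x∈q)

q─p⊆⊤─p : ∀ (q p : Subset n) → q ─ p ⊆ ⊤ ─ p
q─p⊆⊤─p q p = x∈p∧x∉q⇒x∈p─q ∈⊤ ∘ x∈p─q⇒x∉q q p

∣q─p∣≡1+∣q─p∪⁅x⁆∣ : x ∈ q → x ∉ p → ∣ q ─ p ∣ ≡ suc ∣ q ─ (p ∪ ⁅ x ⁆) ∣
∣q─p∣≡1+∣q─p∪⁅x⁆∣ {x = x} {q} {p} x∈q x∉p =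
  trans (x∈p⇒∣p∣≡1+∣p-x∣ (x∈p∧x∉q⇒x∈p─q x∈q x∉p)) (cong (suc ∘ ∣_∣) (p─q─r≡p─q∪r q p ⁅ x ⁆))

∣q─p∪⁅x⁆∣≡∣q─p∣ : x ∉ q → ∣ q ─ (p ∪ ⁅ x ⁆) ∣ ≡ ∣ q ─ p ∣
∣q─p∪⁅x⁆∣≡∣q─p∣ {x = x} {q} {p} x∉q =
  cong ∣_∣ (trans (sym (p─q─r≡p─q∪r q p ⁅ x ⁆)) (x∉p⇒p-x≡p (x∉q ∘ p─q⊆p q p)))

parity : ℕ → ℕ
parity zero = 0
parity (suc zero) = 1
parity (suc (suc m)) = parity m

parity≡%2 : ∀ m → parity m ≡ m % 2
parity≡%2 zero = refl
parity≡%2 (suc zero) = refl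
parity≡%2 (suc (suc m)) =
  trans (parity≡%2 m) (sym (trans (cong (_% 2) (+-comm 2 m)) ([m+n]%n≡m%n m 2)))

parity≤1 : ∀ m → parity m ≤ 1
parity≤1 zero = z≤n
parity≤1 (suc zero) = ≤-refl
parity≤1 (suc (suc m)) = parity≤1 m

parity[m]≢parity[1+m] : ∀ m → parity m ≢ parity (suc m)
parity[m]≢parity[1+m] zero ()
parity[m]≢parity[1+m] (suc zero) ()
parity[m]≢parity[1+m] (suc (suc m)) = parity[m]≢parity[1+m] m

0<parity[1+m]⇒parity[m]≡0 : ∀ m → 0 < parity (suc m) → parity m ≡ 0
0<parity[1+m]⇒parity[m]≡0 zero _ = refl
0<parity[1+m]⇒parity[m]≡0 (suc zero) ()
0<parity[1+m]⇒parity[m]≡0 (suc (suc m)) = 0<parity[1+m]⇒parity[m]≡0 m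

-- The nim-number of a position in which a vertices of L and u vertices
-- in all are unselected; the value at u = 0 < a = 1 is never used.
nimValue : ℕ → ℕ → ℕ
nimValue zero u = 0
nimValue (suc zero) u = suc (parity (suc u))
nimValue (suc (suc a)) u = parity u

nimValue-≢-select∈ : ∀ a u → nimValue a u ≢ nimValue (suc a) (suc u)
nimValue-≢-select∈ zero u ()
nimValue-≢-select∈ (suc zero) u = 1+n≢n
nimValue-≢-select∈ (suc (suc a)) u = parity[m]≢parity[1+m] u

nimValue-≢-select∉ : ∀ a u → nimValue (suc a) u ≢ nimValue (suc a) (suc u)
nimValue-≢-select∉ zero u = parity[m]≢parity[1+m] u ∘ sym ∘ suc-injective
nimValue-≢-select∉ (suc a) u = parity[m]≢parity[1+m] u

nimValue-mex : ∀ a u j → a ≤ u → j < nimValue (suc a) (suc u) →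
               j ≡ nimValue a u ⊎ (a < u × j ≡ nimValue (suc a) u)
nimValue-mex zero u zero _ _ = inj₁ refl
nimValue-mex zero zero (suc j) _ (s≤s ())
nimValue-mex zero (suc u) (suc zero) _ (s≤s 0<p) =
  inj₂ (s≤s z≤n , cong suc (sym (0<parity[1+m]⇒parity[m]≡0 u 0<p)))
nimValue-mex zero (suc u) (suc (suc j)) _ (s≤s j<p) with ≤-trans j<p (parity≤1 (suc u))
... | s≤s ()
nimValue-mex (suc zero) (suc zero) zero _ ()
nimValue-mex (suc zero) (suc (suc u)) zero _ 0<p =
  inj₂ (s≤s (s≤s z≤n) , sym (0<parity[1+m]⇒parity[m]≡0 (suc (suc u)) 0<p))
nimValue-mex (suc (suc a)) u zero _ 0<p = inj₁ (sym (0<parity[1+m]⇒parity[m]≡0 u 0<p))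
nimValue-mex (suc a) u (suc j) _ j<p with ≤-trans j<p (parity≤1 (suc u))
... | s≤s ()

module _ (G : Graph n) where

  generating-⊆ : Generating G p → p ⊆ q → Generating G q
  generating-⊆ genP p⊆q v C convC q⊆C = genP v C convC (q⊆C ∘ p⊆q)

  ⊥-convex : Convex G ⊥
  ⊥-convex _ _ _ a∈⊥ = contradiction a∈⊥ ∉⊥

  ⁅⁆-convex : ∀ v → Convex G ⁅ v ⁆
  ⁅⁆-convex v a b w a∈⁅v⁆ b∈⁅v⁆ (_ , W , geodesic , w∈W)
    with refl ← x∈⁅y⁆⇒x≡y v a∈⁅v⁆ | refl ← x∈⁅y⁆⇒x≡y v b∈⁅v⁆
    = subst (_∈ ⁅ v ⁆) (sym (closed-walk-visits W (geodesic 0 (Walk.here v)) w∈W)) (x∈⁅x⁆ v)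
    where
    closed-walk-visits : ∀ {k} (W : Walk G v v k) → k ≤ 0 → visits G W w → w ≡ v
    closed-walk-visits (Walk.here _) _ w≡v = w≡v

  -- Constructively only the double negation is available (Generating G is not
  -- decidable); it suffices because membership in p is decidable.
  ¬¬minimal-below : Generating G p → Acc _<_ ∣ p ∣ → ¬ ¬ (∃[ r ] (r ⊆ p × MinimalGenerating G r))
  ¬¬minimal-below {p = p} genP (acc rec) none = none (p , ⊆-refl , genP , ¬generating-below)
    where
    ¬generating-below : ∀ r → r ⊂ p → ¬ Generating G r
    ¬generating-below r r⊂p genR = ¬¬minimal-below genR (rec (p⊂q⇒∣p∣<∣q∣ r⊂p))
      (λ (s , s⊆r , minS) → none (s , ⊆-trans s⊆r (p⊂q⇒p⊆q r⊂p) , minS))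

  unique-minimal⇒generating⇔⊇ : ∀ (L : Subset n) → Generating G L →
    (∀ q → MinimalGenerating G q → q ≡ L) → ∀ p → Generating G p ⇔ L ⊆ p
  unique-minimal⇒generating⇔⊇ L genL unique p = mk⇔ L⊆p (generating-⊆ genL)
    where
    L⊆p : Generating G p → L ⊆ p
    L⊆p genP {x} x∈L = decidable-stable (x ∈? p) λ x∉p →
      ¬¬minimal-below genP (<-wellFounded ∣ p ∣)
        (λ (r , r⊆p , minR) → x∉p (r⊆p (subst (x ∈_) (sym (unique r minR)) x∈L)))

generating-⊥⇒n≡0 : (G : Graph n) → Generating G ⊥ → n ≡ 0
generating-⊥⇒n≡0 {zero} _ _ = refl
generating-⊥⇒n≡0 {suc _} G gen = contradiction (gen zero ⊥ (⊥-convex G) ⊆-refl) ∉⊥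

generating-⁅v⁆⇒n≡1 : (G : Graph n) (v : Fin n) → Generating G ⁅ v ⁆ → n ≡ 1
generating-⁅v⁆⇒n≡1 {suc zero} _ _ _ = refl
generating-⁅v⁆⇒n≡1 {suc (suc _)} G v gen =
  contradiction (trans (≡v zero) (sym (≡v (suc zero)))) λ ()
  where
  ≡v : ∀ w → w ≡ v
  ≡v w = x∈⁅y⁆⇒x≡y v (gen w ⁅ v ⁆ (⁅⁆-convex G v) ⊆-refl)

module _ (G : Graph n) where

  terminal-nimIs-0 : Generating G p → ∀ f → NimIs G f p 0
  terminal-nimIs-0 genP zero = genP , refl
  terminal-nimIs-0 genP (suc f) = inj₁ (genP , refl)

  NimIs-functional : ∀ f p {k k′} → NimIs G f p k → NimIs G f p k′ → k ≡ k′
  NimIs-functional zero _ (_ , refl) (_ , refl) = refl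
  NimIs-functional (suc f) _ (inj₁ (_ , refl)) (inj₁ (_ , refl)) = refl
  NimIs-functional (suc f) _ (inj₁ (genP , _)) (inj₂ (¬genP , _)) = contradiction genP ¬genP
  NimIs-functional (suc f) _ (inj₂ (¬genP , _)) (inj₁ (genP , _)) = contradiction genP ¬genP
  NimIs-functional (suc f) _ {k} {k′} (inj₂ (_ , options , mex)) (inj₂ (_ , options′ , mex′))
    with <-cmp k k′
  ... | tri≈ _ k≡k′ _ = k≡k′
  ... | tri< k<k′ _ _ = let (v , v∉p , nimV) = mex′ k k<k′ in
    contradiction refl (options v v∉p k nimV)
  ... | tri> _ _ k′<k = let (v , v∉p , nimV) = mex k′ k′<k in
    contradiction refl (options′ v v∉p k′ nimV)

module _ (G : Graph n) (L : Subset n) (generating⇔⊇ : ∀ p → Generating G p ⇔ L ⊆ p) where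

  nimIs-nimValue : ∀ f p {a u} → ∣ L ─ p ∣ ≡ a → ∣ ⊤ ─ p ∣ ≡ u → u ≤ f →
                   NimIs G f p (nimValue a u)
  nimIs-nimValue f p {zero} ∣L─p∣≡0 _ _ =
    terminal-nimIs-0 G (Equivalence.from (generating⇔⊇ p) (∣q─p∣≡0⇒q⊆p ∣L─p∣≡0)) f
  nimIs-nimValue f p {suc a} {zero} ∣L─p∣≡1+a ∣⊤─p∣≡0 _
    with () ← subst₂ _≤_ ∣L─p∣≡1+a ∣⊤─p∣≡0 (p⊆q⇒∣p∣≤∣q∣ (q─p⊆⊤─p L p))
  nimIs-nimValue zero p {suc a} {suc u} _ _ ()
  nimIs-nimValue (suc f) p {suc a} {suc u} ∣L─p∣≡1+a ∣⊤─p∣≡1+u (s≤s u≤f) =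
    inj₂ (¬genP , options , mex)
    where
    0<∣L─p∣ : 0 < ∣ L ─ p ∣
    0<∣L─p∣ = subst (0 <_) (sym ∣L─p∣≡1+a) (s≤s z≤n)

    ¬genP : ¬ Generating G p
    ¬genP genP = let (v , v∈L , v∉p) = 0<∣q─p∣⇒∃x∈q∖p L p 0<∣L─p∣ in
      v∉p (Equivalence.to (generating⇔⊇ p) genP v∈L)

    ∣⊤─p∪⁅v⁆∣≡u : ∀ {v} → v ∉ p → ∣ ⊤ ─ (p ∪ ⁅ v ⁆) ∣ ≡ u
    ∣⊤─p∪⁅v⁆∣≡u v∉p = suc-injective (trans (sym (∣q─p∣≡1+∣q─p∪⁅x⁆∣ ∈⊤ v∉p)) ∣⊤─p∣≡1+u)

    select∈ : ∀ {v} → v ∈ L → v ∉ p → NimIs G f (p ∪ ⁅ v ⁆) (nimValue a u)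
    select∈ v∈L v∉p = nimIs-nimValue f (p ∪ _)
      (suc-injective (trans (sym (∣q─p∣≡1+∣q─p∪⁅x⁆∣ v∈L v∉p)) ∣L─p∣≡1+a)) (∣⊤─p∪⁅v⁆∣≡u v∉p) u≤f

    select∉ : ∀ {v} → v ∉ L → v ∉ p → NimIs G f (p ∪ ⁅ v ⁆) (nimValue (suc a) u)
    select∉ v∉L v∉p = nimIs-nimValue f (p ∪ _)
      (trans (∣q─p∪⁅x⁆∣≡∣q─p∣ v∉L) ∣L─p∣≡1+a) (∣⊤─p∪⁅v⁆∣≡u v∉p) u≤f

    options : ∀ v → v ∉ p → ∀ m → NimIs G f (p ∪ ⁅ v ⁆) m → m ≢ nimValue (suc a) (suc u)
    options v v∉p m nimM with v ∈? L
    ... | yes v∈L = nimValue-≢-select∈ a u ∘ trans (NimIs-functional G f _ (select∈ v∈L v∉p) nimM)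
    ... | no v∉L = nimValue-≢-select∉ a u ∘ trans (NimIs-functional G f _ (select∉ v∉L v∉p) nimM)

    a≤u : a ≤ u
    a≤u with s≤s a≤u ← subst₂ _≤_ ∣L─p∣≡1+a ∣⊤─p∣≡1+u (p⊆q⇒∣p∣≤∣q∣ (q─p⊆⊤─p L p)) = a≤u

    mex : ∀ j → j < nimValue (suc a) (suc u) → ∃[ v ] (v ∉ p × NimIs G f (p ∪ ⁅ v ⁆) j)
    mex j j<value with nimValue-mex a u j a≤u j<value
    ... | inj₁ refl = let (v , v∈L , v∉p) = 0<∣q─p∣⇒∃x∈q∖p L p 0<∣L─p∣ in v , v∉p , select∈ v∈L v∉p
    ... | inj₂ (a<u , refl)
      with v , v∈⊤─p , v∉L─p ← ∣p∣<∣q∣⇒∃x∈q∖p (subst₂ _<_ (sym ∣L─p∣≡1+a) (sym ∣⊤─p∣≡1+u) (s≤s a<u))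
      = let v∉p = x∈p─q⇒x∉q ⊤ p v∈⊤─p
            v∉L = v∉L─p ∘ λ v∈L → x∈p∧x∉q⇒x∈p─q v∈L v∉p
        in v , v∉p , select∉ v∉L v∉p

  nimValue∣L∣≡n%2 : nimValue ∣ L ∣ n ≡ n % 2
  nimValue∣L∣≡n%2 with ∣ L ∣ in ∣L∣≡k
  ... | zero
    rewrite generating-⊥⇒n≡0 G (Equivalence.from (generating⇔⊇ ⊥) (⊥-elim ∘ ∣p∣≡0⇒x∉p ∣L∣≡k)) = refl
  ... | suc zero with v , L⊆⁅v⁆ ← ∣p∣≡1⇒p⊆⁅x⁆ ∣L∣≡k
    rewrite generating-⁅v⁆⇒n≡1 G v (Equivalence.from (generating⇔⊇ ⁅ v ⁆) L⊆⁅v⁆) = refl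
  ... | suc (suc _) = parity≡%2 n

proposition6p5 : (n : ℕ) (G : Graph n) (L : Subset n)
    → (∀ Q → (MinimalGenerating G Q → Q ≡ L) × (Q ≡ L → MinimalGenerating G Q))
    → NimGEN G (n % 2)
proposition6p5 n G L unique =
  subst (NimGEN G) (nimValue∣L∣≡n%2 G L generating⇔⊇)
    (nimIs-nimValue G L generating⇔⊇ n ⊥ ∣L─⊥∣≡∣L∣ ∣⊤─⊥∣≡n ≤-refl)
  where
  generating⇔⊇ : ∀ p → Generating G p ⇔ L ⊆ p
  generating⇔⊇ = unique-minimal⇒generating⇔⊇ G L (proj₁ (proj₂ (unique L) refl)) (proj₁ ∘ unique)

  ∣L─⊥∣≡∣L∣ : ∣ L ─ ⊥ ∣ ≡ ∣ L ∣
  ∣L─⊥∣≡∣L∣ = cong ∣_∣ (p─⊥≡p L)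

  ∣⊤─⊥∣≡n : ∣ ⊤ {n} ─ ⊥ ∣ ≡ n
  ∣⊤─⊥∣≡n = trans (cong ∣_∣ (p─⊥≡p (⊤ {n}))) (∣⊤∣≡n n)
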